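{- Let $N$ be the size of the ID space and let $2 \leq n \leq N/2$ be the number of devices, where both $N$ and $n$ may be global knowledge. Let $\mathcal{A}$ be any deterministic algorithm in the $\mathsf{No}\text{ - }\mathsf{CD}$ model, described by action sequences $(a_1(x), a_2(x), \ldots)$ for $x \in [N]$, that guarantees a successful transmission within the first $t$ rounds for every choice of the size-$n$ set $V \subseteq [N]$ of device identifiers. For $j \in [N]$ let $k_j = |\{ i \in [t] : a_i(j) \neq \mathsf{idle}\}|$ be the energy cost of a device with ID $j$ in the first $t$ rounds assuming the channel feedback is always silence. Then $\frac{1}{N}\sum_{j=1}^N k_j = \Omega\left(\log \frac{N}{n}\right)$.
   Context: Model: devices are connected to a multiple-access channel; communication is in synchronous rounds with a common time zero; in each round a device transmits, listens, or is idle. In the $\mathsf{No}\text{ - }\mathsf{CD}$ model, transmitters get no feedback, and a listener receives the message if exactly one device transmits and silence otherwise. In the deterministic setting each device has a unique identifier in $[N]$. A successful transmission occurs in a round if exactly one device transmits and at least one device listens in that round (other devices may be idle). Since before the first successful transmission every listener hears only silence, a deterministic algorithm (considered up to its first successful transmission) is specified by a map assigning to each $x \in [N]$ an infinite sequence $(a_1(x), a_2(x), \ldots)$ with $a_i(x) \in \{\mathsf{transmit}, \mathsf{listen}, \mathsf{idle}\}$, the action in round $i$ of the device with ID $x$ given that it has heard only silence in rounds $1,\ldots,i-1$. The constant in $\Omega(\cdot)$ is absolute. -}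

module Defs where

open import Data.Nat using (ℕ; zero; suc; _+_; _<_)
open import Data.Fin using (Fin)
open import Data.Fin.Subset using (Subset; _∈_)
open import Data.List using (List; map; allFin)
open import Data.Nat.ListAction using (sum)
open import Data.Product using (Σ; _×_; ∃-syntax)
open import Relation.Binary.PropositionalEquality using (_≡_)
open import Relation.Nullary using (¬_)

data Action : Set where
  transmit listen idle : Action

-- A deterministic No-CD algorithm (up to its first successful transmission):
-- a i x = action in round (i+1) of the device with ID x, given that it
-- heard only silence so far. Rounds are indexed from 0, IDs by Fin N.
Algorithm : ℕ → Set
Algorithm N = ℕ → Fin N → Action

SuccessIn : ∀ {N} → Algorithm N → Subset N → ℕ → Set
SuccessIn {N} a V i =
  (∃[ x ] (x ∈ V × a i x ≡ transmit
           × (∀ y → y ∈ V → a i y ≡ transmit → y ≡ x)))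
  × (∃[ y ] (y ∈ V × a i y ≡ listen))

SucceedsWithin : ∀ {N} → Algorithm N → Subset N → ℕ → Set
SucceedsWithin a V t = ∃[ i ] (i < t × SuccessIn a V i)

cost : Action → ℕ
cost idle = 0
cost transmit = 1
cost listen = 1

energy : ∀ {N} → Algorithm N → ℕ → Fin N → ℕ
energy a zero j = 0
energy a (suc t) j = energy a t j + cost (a t j)

totalEnergy : ∀ {N} → Algorithm N → ℕ → ℕ
totalEnergy {N} a t = sum (map (energy a t) (allFin N))

{-# OPTIONS --safe #-}
module Submission where

-- Follow the run in which every device hears only silence. Call a set of devices silent if in
-- none of the first t rounds one member transmits while another listens: no subset of it ever
-- sees a successful transmission, so a silent set has fewer than n members. Give device j the
-- weight 2^(t - k_j), i.e. 2 to the number of its idle rounds. Splitting a set at each round into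
-- its non-transmitters and its non-listeners, where an idle device falls into both halves with
-- half its weight in each, shows inductively that some silent subset C of the whole ID space
-- has 2^t |C| >= sum_j 2^(t - k_j); this is the Kraft-type inequality sum_j 2^(-k_j) <= n.
-- For L = floor(log2(N/n)) the convexity bound 2L <= L 2^(L - k) + 2k, averaged with the
-- weights 2^(-k_j), then gives 2NL <= L 2^L n + 2 sum_j k_j <= LN + 2 sum_j k_j.

open import Defs
open import Data.Nat using (ℕ; _*_; _≤_; _/_; NonZero)
open import Data.Nat.Logarithm using (⌊log₂_⌋)
open import Data.Fin.Subset using (Subset; ∣_∣)
open import Data.Product using (∃-syntax; _×_)
open import Relation.Binary.PropositionalEquality using (_≡_)

open import Data.Bool using (Bool; true; false; _∧_; if_then_else_)
open import Data.Nat using (zero; suc; _+_; _^_; _<_; z≤n; s≤s; ⌊_/2⌋; ⌈_/2⌉; >-nonZero)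
open import Data.Nat.Properties
open import Data.Nat.DivMod using (m/n*n≤m; m≥n⇒m/n>0)
open import Data.Nat.Induction using (<-wellFounded)
open import Data.Nat.Logarithm.Core using (⌊log2⌋)
open import Data.Nat.Tactic.RingSolver using (solve-∀)
open import Data.Nat.ListAction using () renaming (sum to sumList)
open import Data.Fin using (Fin)
open import Data.Fin.Subset using (_∈_; _⊆_; _∩_; ⊤; ⊥; inside; outside)
open import Data.Fin.Subset.Properties using (⊆-refl; ⊆-trans; ⊥⊆; ∣⊥∣≡0; out⊆; in⊆in; p∩q⊆p; p∩q⊆q)
import Data.List as List
open import Data.List.Properties using (map-tabulate)
open import Data.Vec using ([]; _∷_; lookup; tabulate)
open import Data.Vec.Properties using (lookup-zipWith; lookup∘tabulate; lookup-replicate; []=⇒lookup)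
open import Data.Vec.Functional using (Vector)
open import Algebra.Properties.Semiring.Sum +-*-semiring using (sum; sum-cong-≗; ∑-distrib-+; *-distribˡ-sum)
open import Data.Product using (_,_)
open import Data.Sum using (inj₁; inj₂)
open import Function using (_∘_)
open import Induction.WellFounded using (Acc; acc)
open import Relation.Binary.PropositionalEquality using (_≢_; refl; sym; trans; cong; cong₂; subst; module ≡-Reasoning)
open import Relation.Nullary using (¬_; contradiction)

∑-mono-≤ : ∀ {N} {f g : Vector ℕ N} → (∀ j → f j ≤ g j) → sum f ≤ sum g
∑-mono-≤ {zero}  f≤g = z≤n
∑-mono-≤ {suc N} f≤g = +-mono-≤ (f≤g Fin.zero) (∑-mono-≤ (f≤g ∘ Fin.suc))

∑-const : ∀ N c → sum {N} (λ _ → c) ≡ N * c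
∑-const zero    c = refl
∑-const (suc N) c = cong (c +_) (∑-const N c)

sum-tabulate : ∀ {N} (f : Vector ℕ N) → sumList (List.tabulate f) ≡ sum f
sum-tabulate {zero}  f = refl
sum-tabulate {suc N} f = cong (f Fin.zero +_) (sum-tabulate (f ∘ Fin.suc))

m+m≡2*m : ∀ m → m + m ≡ 2 * m
m+m≡2*m m = cong (m +_) (sym (+-identityʳ m))

2*⌊n/2⌋≤n : ∀ n → 2 * ⌊ n /2⌋ ≤ n
2*⌊n/2⌋≤n n = begin
  ⌊ n /2⌋ + (⌊ n /2⌋ + 0) ≡⟨ cong (⌊ n /2⌋ +_) (+-identityʳ ⌊ n /2⌋) ⟩
  ⌊ n /2⌋ + ⌊ n /2⌋       ≤⟨ +-monoʳ-≤ ⌊ n /2⌋ (⌊n/2⌋≤⌈n/2⌉ n) ⟩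
  ⌊ n /2⌋ + ⌈ n /2⌉       ≡⟨ ⌊n/2⌋+⌈n/2⌉≡n n ⟩
  n                       ∎
  where open ≤-Reasoning

2^⌊log2⌋n≤n : ∀ n (rec : Acc _<_ n) .{{_ : NonZero n}} → 2 ^ ⌊log2⌋ n rec ≤ n
2^⌊log2⌋n≤n 1             _        = ≤-refl
2^⌊log2⌋n≤n (suc (suc m)) (acc rs) = begin
  2 * 2 ^ ⌊log2⌋ (suc ⌊ m /2⌋) _ ≤⟨ *-monoʳ-≤ 2 (2^⌊log2⌋n≤n (suc ⌊ m /2⌋) _) ⟩
  2 * suc ⌊ m /2⌋                ≡⟨ *-suc 2 ⌊ m /2⌋ ⟩
  2 + 2 * ⌊ m /2⌋                ≤⟨ +-monoʳ-≤ 2 (2*⌊n/2⌋≤n m) ⟩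
  2 + m                          ∎
  where open ≤-Reasoning

2^⌊log₂n⌋≤n : ∀ n .{{_ : NonZero n}} → 2 ^ ⌊log₂ n ⌋ ≤ n
2^⌊log₂n⌋≤n n = 2^⌊log2⌋n≤n n (<-wellFounded n)

2^⌊log₂[m/n]⌋*n≤m : ∀ {m n} .{{_ : NonZero n}} → n ≤ m → 2 ^ ⌊log₂ (m / n) ⌋ * n ≤ m
2^⌊log₂[m/n]⌋*n≤m {m} {n} n≤m =
  ≤-trans (*-monoˡ-≤ n (2^⌊log₂n⌋≤n (m / n) {{>-nonZero (m≥n⇒m/n>0 n≤m)}})) (m/n*n≤m m n)

2*n≤2^n*n : ∀ n → 2 * n ≤ 2 ^ n * n
2*n≤2^n*n zero    = z≤n
2*n≤2^n*n (suc m) = *-monoˡ-≤ (suc m) (*-monoʳ-≤ 2 (m^n>0 2 m))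

2^k*2L≤2^L*L+2^k*2k : ∀ L k → 2 ^ k * (2 * L) ≤ 2 ^ L * L + 2 ^ k * (2 * k)
2^k*2L≤2^L*L+2^k*2k L k with ≤-total L k
... | inj₁ L≤k = ≤-trans (*-monoʳ-≤ (2 ^ k) (*-monoʳ-≤ 2 L≤k)) (m≤n+m _ _)
... | inj₂ k≤L with m≤n⇒∃[o]m+o≡n k≤L
... | d , refl = begin
  2 ^ k * (2 * (k + d))                   ≡⟨ distrib (2 ^ k) k d ⟩
  2 ^ k * (2 * d) + 2 ^ k * (2 * k)       ≤⟨ +-monoˡ-≤ _ (*-monoʳ-≤ (2 ^ k) (2*n≤2^n*n d)) ⟩
  2 ^ k * (2 ^ d * d) + 2 ^ k * (2 * k)   ≡⟨ cong (_+ 2 ^ k * (2 * k)) 2^k*2^d≡2^[k+d] ⟩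
  2 ^ (k + d) * d + 2 ^ k * (2 * k)       ≤⟨ +-monoˡ-≤ _ (*-monoʳ-≤ (2 ^ (k + d)) (m≤n+m d k)) ⟩
  2 ^ (k + d) * (k + d) + 2 ^ k * (2 * k) ∎
  where
  open ≤-Reasoning
  distrib : ∀ e x y → e * (2 * (x + y)) ≡ e * (2 * y) + e * (2 * x)
  distrib = solve-∀
  2^k*2^d≡2^[k+d] : 2 ^ k * (2 ^ d * d) ≡ 2 ^ (k + d) * d
  2^k*2^d≡2^[k+d] = trans (sym (*-assoc (2 ^ k) (2 ^ d) d)) (cong (_* d) (sym (^-distribˡ-+-* 2 k d)))

weighted-convexity : ∀ L k {w P} → 2 ^ k * w ≡ P → P * (2 * L) ≤ 2 ^ L * L * w + P * (2 * k)
weighted-convexity L k {w} {P} 2^k*w≡P = begin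
  P * (2 * L)                          ≡⟨ cong (_* (2 * L)) (sym 2^k*w≡P) ⟩
  2 ^ k * w * (2 * L)                  ≡⟨ swap (2 ^ k) w (2 * L) ⟩
  w * (2 ^ k * (2 * L))                ≤⟨ *-monoʳ-≤ w (2^k*2L≤2^L*L+2^k*2k L k) ⟩
  w * (2 ^ L * L + 2 ^ k * (2 * k))    ≡⟨ distrib w (2 ^ L * L) (2 ^ k) (2 * k) ⟩
  2 ^ L * L * w + 2 ^ k * w * (2 * k)  ≡⟨ cong (λ z → 2 ^ L * L * w + z * (2 * k)) 2^k*w≡P ⟩
  2 ^ L * L * w + P * (2 * k)          ∎
  where
  open ≤-Reasoning
  swap : ∀ e w x → e * w * x ≡ w * (e * x)
  swap = solve-∀
  distrib : ∀ w m e x → w * (m + e * x) ≡ m * w + e * w * x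
  distrib = solve-∀

kraft⇒average-energy : ∀ {N t n L} (k w : Vector ℕ N) →
  (∀ j → 2 ^ k j * w j ≡ 2 ^ t) → sum w ≤ 2 ^ t * n → 2 ^ L * n ≤ N →
  N * L ≤ 2 * sum k
kraft⇒average-energy {N} {t} {n} {L} k w 2^k*w≡2^t kraft 2^Ln≤N =
  +-cancelˡ-≤ (N * L) _ _ (*-cancelˡ-≤ (2 ^ t) {{m^n≢0 2 t}} (begin
    2 ^ t * (N * L + N * L)                             ≡⟨ reshapeˡ N (2 ^ t) L ⟩
    N * (2 ^ t * (2 * L))                               ≡⟨ sym (∑-const N (2 ^ t * (2 * L))) ⟩
    sum {N} (λ _ → 2 ^ t * (2 * L))                     ≤⟨ ∑-mono-≤ (λ j → weighted-convexity L (k j) (2^k*w≡2^t j)) ⟩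
    sum (λ j → M * w j + 2 ^ t * (2 * k j))             ≡⟨ ∑-distrib-+ (λ j → M * w j) (λ j → 2 ^ t * (2 * k j)) ⟩
    sum (λ j → M * w j) + sum (λ j → 2 ^ t * (2 * k j)) ≡⟨ cong₂ _+_ (sym (*-distribˡ-sum M w)) ∑2^t*2k≡2^t*2∑k ⟩
    M * sum w + 2 ^ t * (2 * sum k)                     ≤⟨ +-monoˡ-≤ _ (*-monoʳ-≤ M kraft) ⟩
    M * (2 ^ t * n) + 2 ^ t * (2 * sum k)               ≡⟨ reshapeʳ (2 ^ L) L (2 ^ t) n (2 * sum k) ⟩
    2 ^ t * (L * (2 ^ L * n) + 2 * sum k)               ≤⟨ *-monoʳ-≤ (2 ^ t) (+-monoˡ-≤ _ (*-monoʳ-≤ L 2^Ln≤N)) ⟩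
    2 ^ t * (L * N + 2 * sum k)                         ≡⟨ cong (λ z → 2 ^ t * (z + 2 * sum k)) (*-comm L N) ⟩
    2 ^ t * (N * L + 2 * sum k)                         ∎))
  where
  open ≤-Reasoning
  M = 2 ^ L * L
  ∑2^t*2k≡2^t*2∑k : sum (λ j → 2 ^ t * (2 * k j)) ≡ 2 ^ t * (2 * sum k)
  ∑2^t*2k≡2^t*2∑k =
    sym (trans (cong (2 ^ t *_) (*-distribˡ-sum 2 k)) (*-distribˡ-sum (2 ^ t) (λ j → 2 * k j)))
  reshapeˡ : ∀ N P L → P * (N * L + N * L) ≡ N * (P * (2 * L))
  reshapeˡ = solve-∀
  reshapeʳ : ∀ x L P n y → x * L * (P * n) + P * y ≡ P * (L * (x * n) + y)
  reshapeʳ = solve-∀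

pick-larger : ∀ {A : Set} {P : A → Set} (size : A → ℕ) {x y} →
  P x → P y → ∃[ z ] (P z × size x + size y ≤ 2 * size z)
pick-larger size {x} {y} px py with ≤-total (size x) (size y)
... | inj₁ x≤y = y , py , ≤-trans (+-monoˡ-≤ (size y) x≤y) (≤-reflexive (m+m≡2*m (size y)))
... | inj₂ y≤x = x , px , ≤-trans (+-monoʳ-≤ (size x) y≤x) (≤-reflexive (m+m≡2*m (size x)))

sumOver : ∀ {N} → Subset N → Vector ℕ N → ℕ
sumOver {N} S w = sum {N} (λ j → if lookup S j then w j else 0)

sumOver-1≡∣p∣ : ∀ {N} (p : Subset N) → sumOver p (λ _ → 1) ≡ ∣ p ∣
sumOver-1≡∣p∣ []            = refl
sumOver-1≡∣p∣ (outside ∷ p) = sumOver-1≡∣p∣ p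
sumOver-1≡∣p∣ (inside ∷ p)  = cong suc (sumOver-1≡∣p∣ p)

sumOver-⊤ : ∀ {N} (w : Vector ℕ N) → sumOver ⊤ w ≡ sum w
sumOver-⊤ w = sum-cong-≗ (λ j → cong (λ b → if b then w j else 0) (lookup-replicate j true))

subset-of-size : ∀ {N} (p : Subset N) {n} → n ≤ ∣ p ∣ → ∃[ q ] (q ⊆ p × ∣ q ∣ ≡ n)
subset-of-size {N} p {zero} _ = ⊥ , ⊥⊆ , ∣⊥∣≡0 N
subset-of-size (outside ∷ p) {suc n} n<∣p∣ =
  let q , q⊆p , ∣q∣≡n = subset-of-size p n<∣p∣ in outside ∷ q , out⊆ q⊆p , ∣q∣≡n
subset-of-size (inside ∷ p) {suc n} (s≤s n≤∣p∣) =
  let q , q⊆p , ∣q∣≡n = subset-of-size p n≤∣p∣ in inside ∷ q , in⊆in q⊆p , cong suc ∣q∣≡n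

∈-tabulate⁻ : ∀ {N} {f : Fin N → Bool} {x} → x ∈ tabulate f → f x ≡ true
∈-tabulate⁻ {f = f} {x} x∈ = trans (sym (lookup∘tabulate f x)) ([]=⇒lookup x∈)

lookup-∩-tabulate : ∀ {N} (p : Subset N) (f : Fin N → Bool) j →
  lookup (p ∩ tabulate f) j ≡ lookup p j ∧ f j
lookup-∩-tabulate p f j =
  trans (lookup-zipWith _∧_ j p (tabulate f)) (cong (lookup p j ∧_) (lookup∘tabulate f j))

idleness : Action → ℕ
idleness transmit = 0
idleness listen   = 0
idleness idle     = 1

idles : ∀ {N} → Algorithm N → ℕ → Fin N → ℕ
idles a zero    j = 0
idles a (suc t) j = idles a t j + idleness (a t j)

weight : ∀ {N} → Algorithm N → ℕ → Fin N → ℕ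
weight a t j = 2 ^ idles a t j

energy+idles≡t : ∀ {N} (a : Algorithm N) t j → energy a t j + idles a t j ≡ t
energy+idles≡t a zero    j = refl
energy+idles≡t a (suc t) j = begin
  energy a t j + cost (a t j) + (idles a t j + idleness (a t j)) ≡⟨ interchange (energy a t j) _ _ _ ⟩
  energy a t j + idles a t j + (cost (a t j) + idleness (a t j)) ≡⟨ cong₂ _+_ (energy+idles≡t a t j) (cost+idleness≡1 (a t j)) ⟩
  t + 1                                                            ≡⟨ +-comm t 1 ⟩
  suc t                                                            ∎
  where
  open ≡-Reasoning
  interchange : ∀ e c i d → e + c + (i + d) ≡ e + i + (c + d)
  interchange = solve-∀
  cost+idleness≡1 : ∀ x → cost x + idleness x ≡ 1
  cost+idleness≡1 transmit = refl
  cost+idleness≡1 listen   = refl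
  cost+idleness≡1 idle     = refl

2^energy*weight≡2^t : ∀ {N} (a : Algorithm N) t j → 2 ^ energy a t j * weight a t j ≡ 2 ^ t
2^energy*weight≡2^t a t j =
  trans (sym (^-distribˡ-+-* 2 (energy a t j) (idles a t j))) (cong (2 ^_) (energy+idles≡t a t j))

totalEnergy≡∑energy : ∀ {N} (a : Algorithm N) t → totalEnergy a t ≡ sum (energy a t)
totalEnergy≡∑energy a t =
  trans (cong sumList (map-tabulate (λ j → j) (energy a t))) (sum-tabulate (energy a t))

nonTransmitting nonListening : Action → Bool
nonTransmitting transmit = false
nonTransmitting _        = true
nonListening listen = false
nonListening _      = true

nonTransmitters nonListeners : ∀ {N} → Algorithm N → ℕ → Subset N
nonTransmitters a i = tabulate (nonTransmitting ∘ a i)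
nonListeners    a i = tabulate (nonListening ∘ a i)

SilentIn : ∀ {N} → Algorithm N → ℕ → Subset N → Set
SilentIn a i C = ∀ {x y} → x ∈ C → y ∈ C → a i x ≡ transmit → a i y ≢ listen

SilentWithin : ∀ {N} → Algorithm N → ℕ → Subset N → Set
SilentWithin a t C = ∀ {i} → i < t → SilentIn a i C

⊆nonTransmitters⇒SilentIn : ∀ {N} {a : Algorithm N} {i C} →
  C ⊆ nonTransmitters a i → SilentIn a i C
⊆nonTransmitters⇒SilentIn C⊆ x∈C _ aix≡transmit =
  contradiction (subst (λ b → nonTransmitting b ≡ true) aix≡transmit (∈-tabulate⁻ (C⊆ x∈C))) λ ()

⊆nonListeners⇒SilentIn : ∀ {N} {a : Algorithm N} {i C} →
  C ⊆ nonListeners a i → SilentIn a i C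
⊆nonListeners⇒SilentIn C⊆ _ y∈C _ aiy≡listen =
  contradiction (subst (λ b → nonListening b ≡ true) aiy≡listen (∈-tabulate⁻ (C⊆ y∈C))) λ ()

SilentWithin-suc : ∀ {N} {a : Algorithm N} {t C} →
  SilentWithin a t C → SilentIn a t C → SilentWithin a (suc t) C
SilentWithin-suc before now i<1+t with m<1+n⇒m<n∨m≡n i<1+t
... | inj₁ i<t  = before i<t
... | inj₂ refl = now

⊆-SilentWithin⇒¬SucceedsWithin : ∀ {N} {a : Algorithm N} {t C V} →
  V ⊆ C → SilentWithin a t C → ¬ SucceedsWithin a V t
⊆-SilentWithin⇒¬SucceedsWithin V⊆C silent (_ , i<t , (_ , x∈V , transmits , _) , (_ , y∈V , listens)) =
  silent i<t (V⊆C x∈V) (V⊆C y∈V) transmits listens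

SilentWithin⇒∣C∣<n : ∀ {N} {a : Algorithm N} {t C n} →
  (∀ (V : Subset N) → ∣ V ∣ ≡ n → SucceedsWithin a V t) → SilentWithin a t C → ∣ C ∣ < n
SilentWithin⇒∣C∣<n {C = C} succeeds silent = ≰⇒> λ n≤∣C∣ →
  let V , V⊆C , ∣V∣≡n = subset-of-size C n≤∣C∣ in
  ⊆-SilentWithin⇒¬SucceedsWithin V⊆C silent (succeeds V ∣V∣≡n)

weight-split : ∀ b x d → (if b then 2 ^ (d + idleness x) else 0) ≡
  (if b ∧ nonTransmitting x then 2 ^ d else 0) + (if b ∧ nonListening x then 2 ^ d else 0)
weight-split false x        d = refl
weight-split true  transmit d = cong (2 ^_) (+-identityʳ d)
weight-split true  listen   d = trans (cong (2 ^_) (+-identityʳ d)) (sym (+-identityʳ (2 ^ d)))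
weight-split true  idle     d = trans (cong (2 ^_) (+-comm d 1)) (cong (2 ^ d +_) (+-identityʳ (2 ^ d)))

sumOver-weight-suc : ∀ {N} (a : Algorithm N) t S →
  sumOver S (weight a (suc t)) ≡
  sumOver (S ∩ nonTransmitters a t) (weight a t) + sumOver (S ∩ nonListeners a t) (weight a t)
sumOver-weight-suc {N} a t S = trans (sum-cong-≗ pointwise) (∑-distrib-+ (term S₀) (term S₁))
  where
  S₀ = S ∩ nonTransmitters a t
  S₁ = S ∩ nonListeners a t
  term : Subset N → Fin N → ℕ
  term p j = if lookup p j then weight a t j else 0
  term-∩ : ∀ f j → term (S ∩ tabulate f) j ≡ (if lookup S j ∧ f j then weight a t j else 0)
  term-∩ f j = cong (λ b → if b then weight a t j else 0) (lookup-∩-tabulate S f j)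
  pointwise : ∀ j → (if lookup S j then weight a (suc t) j else 0) ≡ term S₀ j + term S₁ j
  pointwise j = trans (weight-split (lookup S j) (a t j) (idles a t j))
    (sym (cong₂ _+_ (term-∩ (nonTransmitting ∘ a t) j) (term-∩ (nonListening ∘ a t) j)))

SilentSubsetOf : ∀ {N} → Algorithm N → ℕ → Subset N → Subset N → Set
SilentSubsetOf a t S C = C ⊆ S × SilentWithin a t C

SilentSubsetOf-∩nonTransmitters : ∀ {N} {a : Algorithm N} {t S C} →
  SilentSubsetOf a t (S ∩ nonTransmitters a t) C → SilentSubsetOf a (suc t) S C
SilentSubsetOf-∩nonTransmitters {a = a} {t} {S} (C⊆ , silent) =
  ⊆-trans C⊆ (p∩q⊆p S _) ,
  SilentWithin-suc silent (⊆nonTransmitters⇒SilentIn {a = a} {i = t} (⊆-trans C⊆ (p∩q⊆q S _)))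

SilentSubsetOf-∩nonListeners : ∀ {N} {a : Algorithm N} {t S C} →
  SilentSubsetOf a t (S ∩ nonListeners a t) C → SilentSubsetOf a (suc t) S C
SilentSubsetOf-∩nonListeners {a = a} {t} {S} (C⊆ , silent) =
  ⊆-trans C⊆ (p∩q⊆p S _) ,
  SilentWithin-suc silent (⊆nonListeners⇒SilentIn {a = a} {i = t} (⊆-trans C⊆ (p∩q⊆q S _)))

large-silent-subset : ∀ {N} (a : Algorithm N) t (S : Subset N) →
  ∃[ C ] (SilentSubsetOf a t S C × sumOver S (weight a t) ≤ 2 ^ t * ∣ C ∣)
large-silent-subset a zero    S =
  S , (⊆-refl , λ ()) , ≤-reflexive (trans (sumOver-1≡∣p∣ S) (sym (*-identityˡ ∣ S ∣)))
large-silent-subset a (suc t) S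
  with large-silent-subset a t (S ∩ nonTransmitters a t) | large-silent-subset a t (S ∩ nonListeners a t)
... | C₀ , silent₀ , bound₀ | C₁ , silent₁ , bound₁
  with pick-larger {P = SilentSubsetOf a (suc t) S} ∣_∣
         (SilentSubsetOf-∩nonTransmitters silent₀) (SilentSubsetOf-∩nonListeners silent₁)
... | C , silent , sizes = C , silent , (begin
    sumOver S (weight a (suc t))                      ≡⟨ sumOver-weight-suc a t S ⟩
    sumOver S₀ (weight a t) + sumOver S₁ (weight a t) ≤⟨ +-mono-≤ bound₀ bound₁ ⟩
    2 ^ t * ∣ C₀ ∣ + 2 ^ t * ∣ C₁ ∣                   ≡⟨ sym (*-distribˡ-+ (2 ^ t) ∣ C₀ ∣ ∣ C₁ ∣) ⟩
    2 ^ t * (∣ C₀ ∣ + ∣ C₁ ∣)                         ≤⟨ *-monoʳ-≤ (2 ^ t) sizes ⟩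
    2 ^ t * (2 * ∣ C ∣)                               ≡⟨ swap (2 ^ t) ∣ C ∣ ⟩
    2 ^ suc t * ∣ C ∣                                 ∎)
  where
  open ≤-Reasoning
  S₀ = S ∩ nonTransmitters a t
  S₁ = S ∩ nonListeners a t
  swap : ∀ p c → p * (2 * c) ≡ 2 * p * c
  swap = solve-∀

kraft-inequality : ∀ {N n t} (a : Algorithm N) →
  (∀ (V : Subset N) → ∣ V ∣ ≡ n → SucceedsWithin a V t) → sum (weight a t) ≤ 2 ^ t * n
kraft-inequality {n = n} {t} a succeeds =
  let C , (_ , silent) , bound = large-silent-subset a t ⊤ in begin
    sum (weight a t)       ≡⟨ sym (sumOver-⊤ (weight a t)) ⟩
    sumOver ⊤ (weight a t) ≤⟨ bound ⟩
    2 ^ t * ∣ C ∣          ≤⟨ *-monoʳ-≤ (2 ^ t) (<⇒≤ (SilentWithin⇒∣C∣<n succeeds silent)) ⟩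
    2 ^ t * n              ∎
  where open ≤-Reasoning

lemma2p1 : ∃[ c ] (1 ≤ c × (∀ (N n t : ℕ) .{{_ : NonZero n}} (a : Algorithm N) →
               2 ≤ n → 2 * n ≤ N →
               (∀ (V : Subset N) → ∣ V ∣ ≡ n → SucceedsWithin a V t) →
               N * ⌊log₂ (N / n) ⌋ ≤ c * totalEnergy a t))
lemma2p1 = 2 , s≤s z≤n , λ N n t a _ 2n≤N succeeds →
  subst (λ K → N * ⌊log₂ (N / n) ⌋ ≤ 2 * K) (sym (totalEnergy≡∑energy a t))
    (kraft⇒average-energy {t = t} (energy a t) (weight a t)
      (2^energy*weight≡2^t a t)
      (kraft-inequality a succeeds)
      (2^⌊log₂[m/n]⌋*n≤m (≤-trans (m≤m+n n (n + 0)) 2n≤N)))
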